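{- Let $\mathcal{C}$ be a full comprehension category satisfying condition (LF). If $\mathcal{C}$ has weakly stable dependent products, then the split comprehension category $\mathcal{C}_!$ has strictly stable dependent products.
   Context: A full comprehension category $\mathcal{C}=(\mathcal{C},\mathcal{T},p,\chi)$: a category $\mathcal{C}$, a cloven Grothendieck fibration $p:\mathcal{T}\to\mathcal{C}$, a fully faithful functor $\chi:\mathcal{T}\to\mathcal{C}^{\to}$ with $\mathrm{cod}\circ\chi=p$ sending cartesian arrows to pullback squares; split if the cleaving is strictly functorial. For $A\in\mathcal{T}(\Gamma)$, $\chi(A):\Gamma.A\to\Gamma$; display maps are composites of these. For $\sigma:\Delta\to\Gamma$, $A[\sigma]$ is the cleaving's reindexing; $f[\sigma]$ the induced reindexing of a map $f$ in a fibre (maps in fibres identified with maps over the base via $\chi$). A section of $A$ is a section of $\chi(A)$. Condition (LF): $\mathcal{C}$ has finite products, and for all $Z\xrightarrow{g}Y\xrightarrow{f}X$ with $f$ a display map and $g$ a display map or product projection, a dependent exponential exists (an object $\prod[f,g]$ of $\mathcal{C}/X$ with $\mathcal{C}/X(W,\prod[f,g])\cong\mathcal{C}/Y(W\times_XY,Z)$ naturally in $W\to X$). $\mathcal{C}_!$: same base; objects of $\mathcal{T}_!$ over $\Gamma$ are triples $A=(V_A,E_A,n_A)$, $V_A\in\mathcal{C}$, $E_A\in\mathcal{T}(V_A)$, $n_A:\Gamma\to V_A$, with $[A]:=E_A[n_A]$; morphisms $B\to A$ over $\sigma$ are morphisms $[B]\to[A]$ over $\sigma$ in $\mathcal{T}$;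 $(V_A,E_A,n_A)[\sigma]:=(V_A,E_A,n_A\circ\sigma)$ with the canonical cartesian map $[A[\sigma]]\to[A]$ (a split fibration); $\chi_!(A):=\chi([A])$. Dependent product for $A\in\mathcal{T}(\Gamma)$, $B\in\mathcal{T}(\Gamma.A)$: $\Pi[A,B]\in\mathcal{T}(\Gamma)$, a map $\mathrm{app}_{A,B}:\Pi[A,B][\chi(A)]\to B$ in $\mathcal{T}(\Gamma.A)$, and for each section $t$ of $B$ a section $\lambda(t)$ of $\Pi[A,B]$ with $(\Gamma.A.\mathrm{app}_{A,B})\circ(1_{\Gamma.A},\lambda(t))=t$. Weakly stable dependent products: every $\Gamma,A,B$ has some $(\Pi[A,B],\mathrm{app}_{A,B})$ such that for every $\sigma:\Delta\to\Gamma$ some operation $\lambda$ makes $(\Pi[A,B][\sigma],\mathrm{app}_{A,B}[\sigma],\lambda)$ a dependent product for $A[\sigma],B[\sigma]$. Strictly stable dependent products (split case): chosen operations $\Pi,\mathrm{app},\lambda$ with $\Pi[A,B][\sigma]=\Pi[A[\sigma],B[\sigma]]$, $\mathrm{app}_{A,B}[\sigma]=\mathrm{app}_{A[\sigma],B[\sigma]}$, $\lambda(t)[\sigma]=\lambda(t[\sigma])$. -}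

module Defs where

-- Conventions:
-- * categories have hom-types with propositional equality (set-level reading);
-- * the fibration p : T → C is presented as a displayed category over C
--   (fibres Ob Γ, maps Hom[ σ ] B A over σ);
-- * the comprehension χ is presented by Γ.A (ext), χ(A) (π A) and χ on maps.

open import Level using (Level; _⊔_) renaming (suc to lsuc)
open import Relation.Binary.PropositionalEquality
  using (_≡_; refl; sym; trans; cong; subst)
open import Data.Product using (Σ; _×_; _,_; proj₁; proj₂; Σ-syntax)
open import Data.Sum using (_⊎_)

Unique : ∀ {a b} {A : Set a} → (A → Set b) → Set (a ⊔ b)
Unique {A = A} P = Σ[ x ∈ A ] (P x × (∀ y → P y → y ≡ x))

record Category (o h : Level) : Set (lsuc (o ⊔ h)) where
  infixr 9 _∘_
  field
    Obj : Set o
    Hom : Obj → Obj → Set h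
    id  : ∀ {X} → Hom X X
    _∘_ : ∀ {X Y Z} → Hom Y Z → Hom X Y → Hom X Z
    identityˡ : ∀ {X Y} {f : Hom X Y} → id ∘ f ≡ f
    identityʳ : ∀ {X Y} {f : Hom X Y} → f ∘ id ≡ f
    assoc : ∀ {W X Y Z} {f : Hom Y Z} {g : Hom X Y} {k : Hom W X} →
            (f ∘ g) ∘ k ≡ f ∘ (g ∘ k)

module CatNotions {o h} (C : Category o h) where
  open Category C

  IsTerminal : Obj → Set (o ⊔ h)
  IsTerminal T = ∀ X → Σ[ f ∈ Hom X T ] (∀ g → g ≡ f)

  IsProduct : ∀ {P X Y} → Hom P X → Hom P Y → Set (o ⊔ h)
  IsProduct {P} {X} {Y} p₁ p₂ =
    ∀ {Q} (f : Hom Q X) (g : Hom Q Y) →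
      Unique (λ (u : Hom Q P) → (p₁ ∘ u ≡ f) × (p₂ ∘ u ≡ g))

  HasFiniteProducts : Set (o ⊔ h)
  HasFiniteProducts =
    (Σ[ T ∈ Obj ] IsTerminal T) ×
    (∀ X Y → Σ[ P ∈ Obj ] Σ[ p₁ ∈ Hom P X ] Σ[ p₂ ∈ Hom P Y ] IsProduct p₁ p₂)

  IsPullback : ∀ {P A B X} → Hom P A → Hom P B → Hom A X → Hom B X → Set (o ⊔ h)
  IsPullback {P} {A} {B} p₁ p₂ f g =
    (f ∘ p₁ ≡ g ∘ p₂) ×
    (∀ {Q} (q₁ : Hom Q A) (q₂ : Hom Q B) → f ∘ q₁ ≡ g ∘ q₂ →
       Unique (λ (u : Hom Q P) → (p₁ ∘ u ≡ q₁) × (p₂ ∘ u ≡ q₂)))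

  IsProductProjection : ∀ {Z Y} → Hom Z Y → Set (o ⊔ h)
  IsProductProjection {Z} g = Σ[ W ∈ Obj ] Σ[ q ∈ Hom Z W ] IsProduct g q

  -- Dependent exponential Π[f,g] for Z --g--> Y --f--> X, given by its
  -- universal property: an object e : E → X of C/X with an evaluation
  -- ev : E ×_X Y → Z over Y such that every h : W ×_X Y → Z over Y
  -- corresponds to a unique k : W → E over X with ev ∘ (k ×_X Y) = h.
  DepExp : ∀ {X Y Z} → Hom Y X → Hom Z Y → Set (o ⊔ h)
  DepExp {X} {Y} {Z} f g =
    Σ[ E ∈ Obj ] Σ[ e ∈ Hom E X ]
    Σ[ P ∈ Obj ] Σ[ p ∈ Hom P E ] Σ[ f' ∈ Hom P Y ]
    (IsPullback p f' e f ×
     (Σ[ ev ∈ Hom P Z ]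
      ((g ∘ ev ≡ f') ×
       (∀ {W Q} (w : Hom W X) (q₁ : Hom Q W) (q₂ : Hom Q Y) →
          IsPullback q₁ q₂ w f →
          (k' : Hom Q Z) → g ∘ k' ≡ q₂ →
          Unique (λ (k : Hom W E) →
            (e ∘ k ≡ w) ×
            (∀ (m : Hom Q P) → p ∘ m ≡ k ∘ q₁ → f' ∘ m ≡ q₂ → ev ∘ m ≡ k'))))))

module _ {o h} (C : Category o h) where
  open Category C

  record Displayed (o' h' : Level) : Set (o ⊔ h ⊔ lsuc (o' ⊔ h')) where
    infixr 9 _∘ᴰ_
    field
      Ob     : Obj → Set o'
      Hom[_] : ∀ {Δ Γ} → Hom Δ Γ → Ob Δ → Ob Γ → Set h'
      idᴰ    : ∀ {Γ} {X : Ob Γ} → Hom[ id ] X X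
      _∘ᴰ_   : ∀ {Θ Δ Γ} {σ : Hom Δ Γ} {τ : Hom Θ Δ} {X Y Z} →
               Hom[ σ ] Y Z → Hom[ τ ] X Y → Hom[ σ ∘ τ ] X Z

    castᴰ : ∀ {Δ Γ} {σ σ' : Hom Δ Γ} {X Y} → σ ≡ σ' → Hom[ σ ] X Y → Hom[ σ' ] X Y
    castᴰ {X = X} {Y} e f = subst (λ s → Hom[ s ] X Y) e f

    IsCartesian : ∀ {Δ Γ} {σ : Hom Δ Γ} {B A} → Hom[ σ ] B A → Set (o ⊔ h ⊔ o' ⊔ h')
    IsCartesian {Δ} {Γ} {σ} {B} {A} f =
      ∀ {Θ} (τ : Hom Θ Δ) (X : Ob Θ) (k : Hom[ σ ∘ τ ] X A) →
        Unique (λ (g : Hom[ τ ] X B) → f ∘ᴰ g ≡ k)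

  module _ {o' h'} (D : Displayed o' h') where
    open Displayed D

    record DisplayedLaws : Set (o ⊔ h ⊔ o' ⊔ h') where
      field
        identityˡᴰ : ∀ {Δ Γ} {σ : Hom Δ Γ} {X Y} (f : Hom[ σ ] X Y) →
                     castᴰ identityˡ (idᴰ ∘ᴰ f) ≡ f
        identityʳᴰ : ∀ {Δ Γ} {σ : Hom Δ Γ} {X Y} (f : Hom[ σ ] X Y) →
                     castᴰ identityʳ (f ∘ᴰ idᴰ) ≡ f
        assocᴰ : ∀ {A B Γ Δ} {σ : Hom Γ Δ} {τ : Hom B Γ} {ρ : Hom A B}
                   {W X Y Z} (f : Hom[ σ ] Y Z) (g : Hom[ τ ] X Y) (k : Hom[ ρ ] W X) →
                 castᴰ assoc ((f ∘ᴰ g) ∘ᴰ k) ≡ f ∘ᴰ (g ∘ᴰ k)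

    -- data of a cloven comprehension category: cleaving (reindexing, lifts,
    -- factorisation through lifts) and comprehension (Γ.A, χ(A), χ on maps,
    -- with cod ∘ χ = p).
    record CompData : Set (o ⊔ h ⊔ lsuc (o' ⊔ h')) where
      field
        _[_]   : ∀ {Δ Γ} → Ob Γ → Hom Δ Γ → Ob Δ
        lift   : ∀ {Δ Γ} (A : Ob Γ) (σ : Hom Δ Γ) → Hom[ σ ] (A [ σ ]) A
        factor : ∀ {Δ Γ} (A : Ob Γ) (σ : Hom Δ Γ) {Θ} {τ : Hom Θ Δ} {X : Ob Θ} →
                 Hom[ σ ∘ τ ] X A → Hom[ τ ] X (A [ σ ])
        ext    : (Γ : Obj) → Ob Γ → Obj
        π      : ∀ {Γ} (A : Ob Γ) → Hom (ext Γ A) Γ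
        χ      : ∀ {Δ Γ} {σ : Hom Δ Γ} {B A} → Hom[ σ ] B A → Hom (ext Δ B) (ext Γ A)
        χ-square : ∀ {Δ Γ} {σ : Hom Δ Γ} {B A} (f : Hom[ σ ] B A) →
                   π A ∘ χ f ≡ σ ∘ π B

    module _ (K : CompData) where
      open CatNotions C
      open CompData K

      record CompLaws : Set (o ⊔ h ⊔ o' ⊔ h') where
        field
          factor-comm : ∀ {Δ Γ} (A : Ob Γ) (σ : Hom Δ Γ) {Θ} {τ : Hom Θ Δ} {X : Ob Θ}
                          (k : Hom[ σ ∘ τ ] X A) → lift A σ ∘ᴰ factor A σ k ≡ k
          factor-unique : ∀ {Δ Γ} (A : Ob Γ) (σ : Hom Δ Γ) {Θ} {τ : Hom Θ Δ} {X : Ob Θ}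
                            (k : Hom[ σ ∘ τ ] X A) (g : Hom[ τ ] X (A [ σ ])) →
                          lift A σ ∘ᴰ g ≡ k → g ≡ factor A σ k
          χ-id : ∀ {Γ} {A : Ob Γ} → χ (idᴰ {X = A}) ≡ id
          χ-∘  : ∀ {Θ Δ Γ} {σ : Hom Δ Γ} {τ : Hom Θ Δ} {X Y Z}
                   (f : Hom[ σ ] Y Z) (g : Hom[ τ ] X Y) → χ (f ∘ᴰ g) ≡ χ f ∘ χ g
          χ-fully-faithful : ∀ {Δ Γ} {σ : Hom Δ Γ} {B : Ob Δ} {A : Ob Γ}
                               (k : Hom (ext Δ B) (ext Γ A)) → π A ∘ k ≡ σ ∘ π B →
                             Unique (λ (f : Hom[ σ ] B A) → χ f ≡ k)
          χ-cartesian : ∀ {Δ Γ} {σ : Hom Δ Γ} {B A} (f : Hom[ σ ] B A) →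
                        IsCartesian f → IsPullback (χ f) (π B) (π A) σ

record FullCompCat (o h o' h' : Level) : Set (lsuc (o ⊔ h ⊔ o' ⊔ h')) where
  field
    C    : Category o h
    T    : Displayed C o' h'
    T-laws : DisplayedLaws C T
    K    : CompData C T
    K-laws : CompLaws C T K

module _ {o h o' h'} {C : Category o h} {D : Displayed C o' h'} (K : CompData C D) where
  open Category C
  open CatNotions C
  open Displayed D
  open CompData K

  data IsDisplay : ∀ {Y X} → Hom Y X → Set (o ⊔ h ⊔ o') where
    one  : ∀ {Γ} (A : Ob Γ) → IsDisplay (π A)
    more : ∀ {Γ X} {d : Hom Γ X} (A : Ob Γ) → IsDisplay d → IsDisplay (d ∘ π A)

  LF : Set (o ⊔ h ⊔ o')
  LF = HasFiniteProducts ×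
       (∀ {X Y Z} (f : Hom Y X) (g : Hom Z Y) →
          IsDisplay f → (IsDisplay g ⊎ IsProductProjection g) → DepExp f g)

  Section : ∀ {Γ} → Ob Γ → Set h
  Section {Γ} A = Σ[ s ∈ Hom Γ (ext Γ A) ] (π A ∘ s ≡ id)

  -- σ.A = χ(lift) : Δ.A[σ] → Γ.A  ; "B[σ]" means B[σ.A]
  q : ∀ {Δ Γ} (σ : Hom Δ Γ) (A : Ob Γ) → Hom (ext Δ (A [ σ ])) (ext Γ A)
  q σ A = χ (lift A σ)

  canon : ∀ {Δ Γ} (P A : Ob Γ) (σ : Hom Δ Γ) →
          Hom[ q σ A ] ((P [ σ ]) [ π (A [ σ ]) ]) (P [ π A ])
  canon P A σ =
    factor P (π A) (castᴰ (sym (χ-square (lift A σ)))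
                          (lift P σ ∘ᴰ lift (P [ σ ]) (π (A [ σ ]))))

  -- app[σ] : P[σ][χ(A[σ])] → B[σ.A], the reindexing of app along σ.A,
  -- precomposed with the canonical comparison of reindexings: the unique
  -- vertical map whose composite with lift_B(σ.A) is app ∘ canon.
  reindexApp : ∀ {Δ Γ} {A P : Ob Γ} {B : Ob (ext Γ A)} (σ : Hom Δ Γ) →
               Hom[ id ] (P [ π A ]) B →
               Hom[ id ] ((P [ σ ]) [ π (A [ σ ]) ]) (B [ q σ A ])
  reindexApp {A = A} {P} {B} σ app =
    factor B (q σ A) (castᴰ (trans identityˡ (sym identityʳ)) (app ∘ᴰ canon P A σ))

  IsDepProd : ∀ {Γ} (A : Ob Γ) (B : Ob (ext Γ A)) (P : Ob Γ) →
              Hom[ id ] (P [ π A ]) B → (Section B → Section P) → Set h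
  IsDepProd {Γ} A B P app lam =
    ∀ (t : Section B) (u : Hom (ext Γ A) (ext (ext Γ A) (P [ π A ]))) →
      π (P [ π A ]) ∘ u ≡ id →
      χ (lift P (π A)) ∘ u ≡ proj₁ (lam t) ∘ π A →
      χ app ∘ u ≡ proj₁ t

  WeakDepProducts : Set (o ⊔ h ⊔ o' ⊔ h')
  WeakDepProducts =
    ∀ {Γ} (A : Ob Γ) (B : Ob (ext Γ A)) →
      Σ[ P ∈ Ob Γ ] Σ[ app ∈ Hom[ id ] (P [ π A ]) B ]
        (∀ {Δ} (σ : Hom Δ Γ) →
          Σ[ lam ∈ (Section (B [ q σ A ]) → Section (P [ σ ])) ]
            IsDepProd (A [ σ ]) (B [ q σ A ]) (P [ σ ]) (reindexApp σ app) lam)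

  record StrictDepProducts : Set (o ⊔ h ⊔ o' ⊔ h') where
    field
      Πᶜ  : ∀ {Γ} (A : Ob Γ) → Ob (ext Γ A) → Ob Γ
      app : ∀ {Γ} (A : Ob Γ) (B : Ob (ext Γ A)) → Hom[ id ] (Πᶜ A B [ π A ]) B
      lam : ∀ {Γ} (A : Ob Γ) (B : Ob (ext Γ A)) → Section B → Section (Πᶜ A B)
      isDepProd : ∀ {Γ} (A : Ob Γ) (B : Ob (ext Γ A)) →
                  IsDepProd A B (Πᶜ A B) (app A B) (lam A B)
      Π-stable : ∀ {Δ Γ} (A : Ob Γ) (B : Ob (ext Γ A)) (σ : Hom Δ Γ) →
                 Πᶜ A B [ σ ] ≡ Πᶜ (A [ σ ]) (B [ q σ A ])
      app-stable : ∀ {Δ Γ} (A : Ob Γ) (B : Ob (ext Γ A)) (σ : Hom Δ Γ) →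
                   subst (λ X → Hom[ id ] (X [ π (A [ σ ]) ]) (B [ q σ A ]))
                         (Π-stable A B σ) (reindexApp σ (app A B))
                   ≡ app (A [ σ ]) (B [ q σ A ])
      -- λ(t)[σ] = λ(t[σ]), where u = t[σ] and v = λ(t)[σ] are the
      -- reindexed sections (characterised by the pullback property)
      lam-stable : ∀ {Δ Γ} (A : Ob Γ) (B : Ob (ext Γ A)) (σ : Hom Δ Γ)
                     (t : Section B) (u : Section (B [ q σ A ]))
                     (v : Section (Πᶜ A B [ σ ])) →
                   χ (lift B (q σ A)) ∘ proj₁ u ≡ proj₁ t ∘ q σ A →
                   χ (lift (Πᶜ A B) σ) ∘ proj₁ v ≡ proj₁ (lam A B t) ∘ σ →
                   subst (λ X → Hom Δ (ext Δ X)) (Π-stable A B σ) (proj₁ v)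
                   ≡ proj₁ (lam (A [ σ ]) (B [ q σ A ]) u)

module Shriek {o h o' h'} {C : Category o h} {D : Displayed C o' h'} (K : CompData C D) where
  open Category C
  open Displayed D
  open CompData K

  Ob! : Obj → Set (o ⊔ h ⊔ o')
  Ob! Γ = Σ[ V ∈ Obj ] Σ[ E ∈ Ob V ] Hom Γ V

  ⟦_⟧ : ∀ {Γ} → Ob! Γ → Ob Γ
  ⟦ V , E , n ⟧ = E [ n ]

  D! : Displayed C (o ⊔ h ⊔ o') h'
  D! = record
    { Ob = Ob!
    ; Hom[_] = λ σ B A → Hom[ σ ] ⟦ B ⟧ ⟦ A ⟧
    ; idᴰ = idᴰ
    ; _∘ᴰ_ = _∘ᴰ_
    }

  K! : CompData C D!
  K! = record
    { _[_] = λ { (V , E , n) σ → (V , E , n ∘ σ) }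
    ; lift = λ { (V , E , n) σ → factor E n (lift E (n ∘ σ)) }
    ; factor = λ { (V , E , n) σ k → factor E (n ∘ σ) (castᴰ (sym assoc) (lift E n ∘ᴰ k)) }
    ; ext = λ Γ A → ext Γ ⟦ A ⟧
    ; π = λ A → π ⟦ A ⟧
    ; χ = χ
    ; χ-square = χ-square
    }

_! : ∀ {o h o' h'} (𝒞 : FullCompCat o h o' h') →
     CompData (FullCompCat.C 𝒞) (Shriek.D! (FullCompCat.K 𝒞))
𝒞 ! = Shriek.K! (FullCompCat.K 𝒞)

module Submission where

-- Strictness comes from classifying maps. By (LF) the dependent exponential V of a product
-- projection along χ(EA) classifies pairs (nA : Γ → VA, nB : Γ.EA[nA] → VB), and carries a
-- generic pair (Agen, Bgen). Choose a weak dependent product Πgen of Bgen over V and put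
-- Π(A, B) := (V, Πgen, n) with n the classifying map of (nA, nB); classifying maps are natural,
-- so n ∘ σ is the classifying map of the reindexed pair and Π is strictly stable. Application is
-- the generic application pulled back along n. For λ, a second classifier Tm.V classifies pairs
-- (nA, term of B), and weak stability of Πgen along typeOf : Tm.V → V yields a generic λ-term;
-- λ(t) is that generic λ-term reindexed along the classifying map of t, hence again stable.

open import Relation.Binary.PropositionalEquality
  using (_≡_; refl; sym; trans; cong; subst; module ≡-Reasoning)
open import Relation.Binary.PropositionalEquality.Properties using (subst-∘)
open import Data.Product using (_×_; _,_; proj₁; proj₂; Σ-syntax)
open import Data.Sum using (inj₂)
open import Axiom.UniquenessOfIdentityProofs.WithK using (uip)
open import Defs

module CategoryReasoning {o h} (C : Category o h) where
  open Category C

  infixr 4 refl⟩∘⟨_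
  infixl 5 _⟩∘⟨refl

  refl⟩∘⟨_ : ∀ {X Y Z} {f : Hom Y Z} {g g′ : Hom X Y} → g ≡ g′ → f ∘ g ≡ f ∘ g′
  refl⟩∘⟨_ {f = f} = cong (f ∘_)

  _⟩∘⟨refl : ∀ {X Y Z} {f f′ : Hom Y Z} {g : Hom X Y} → f ≡ f′ → f ∘ g ≡ f′ ∘ g
  _⟩∘⟨refl {g = g} = cong (_∘ g)

  pullˡ : ∀ {W X Y Z} {f : Hom Y Z} {g : Hom X Y} {fg : Hom X Z} {k : Hom W X} →
          f ∘ g ≡ fg → f ∘ (g ∘ k) ≡ fg ∘ k
  pullˡ e = trans (sym assoc) (e ⟩∘⟨refl)

  pullʳ : ∀ {W X Y Z} {f : Hom Y Z} {g : Hom X Y} {k : Hom W X} {gk : Hom W Y} →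
          g ∘ k ≡ gk → (f ∘ g) ∘ k ≡ f ∘ gk
  pullʳ e = trans assoc (refl⟩∘⟨ e)

module Limits {o h} (C : Category o h) where
  open Category C
  open CatNotions C
  open CategoryReasoning C

  IsPullback-swap : ∀ {P A B X} {a : Hom P A} {b : Hom P B} {f : Hom A X} {g : Hom B X} →
                    IsPullback a b f g → IsPullback b a g f
  IsPullback-swap (commutes , universal) =
    sym commutes , λ y x e →
      let (u , (ay , bx) , unique) = universal x y (sym e)
      in u , (bx , ay) , λ v (bv , av) → unique v (av , bv)

  module Pullback {P A B X} {a : Hom P A} {b : Hom P B} {f : Hom A X} {g : Hom B X}
                  (pb : IsPullback a b f g) where
    opaque
      universal : ∀ {Q} (x : Hom Q A) (y : Hom Q B) → f ∘ x ≡ g ∘ y → Hom Q P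
      universal x y e = proj₁ (proj₂ pb x y e)

      p₁∘universal : ∀ {Q} {x : Hom Q A} {y : Hom Q B} {e : f ∘ x ≡ g ∘ y} →
                     a ∘ universal x y e ≡ x
      p₁∘universal {x = x} {y} {e} = proj₁ (proj₁ (proj₂ (proj₂ pb x y e)))

      p₂∘universal : ∀ {Q} {x : Hom Q A} {y : Hom Q B} {e : f ∘ x ≡ g ∘ y} →
                     b ∘ universal x y e ≡ y
      p₂∘universal {x = x} {y} {e} = proj₂ (proj₁ (proj₂ (proj₂ pb x y e)))

    unique-diagram : ∀ {Q} {u v : Hom Q P} → a ∘ u ≡ a ∘ v → b ∘ u ≡ b ∘ v → u ≡ v
    unique-diagram {u = u} {v} au bu =
      let (_ , _ , unique) = proj₂ pb (a ∘ v) (b ∘ v)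
                                      (trans (sym assoc) (trans (proj₁ pb ⟩∘⟨refl) assoc))
      in trans (unique u (au , bu)) (sym (unique v (refl , refl)))

  module Product {P X Y} {p₁ : Hom P X} {p₂ : Hom P Y} (isProduct : IsProduct p₁ p₂) where
    ⟨_,_⟩ : ∀ {Q} → Hom Q X → Hom Q Y → Hom Q P
    ⟨ x , y ⟩ = proj₁ (isProduct x y)

    project₁ : ∀ {Q} {x : Hom Q X} {y : Hom Q Y} → p₁ ∘ ⟨ x , y ⟩ ≡ x
    project₁ {x = x} {y} = proj₁ (proj₁ (proj₂ (isProduct x y)))

    project₂ : ∀ {Q} {x : Hom Q X} {y : Hom Q Y} → p₂ ∘ ⟨ x , y ⟩ ≡ y
    project₂ {x = x} {y} = proj₂ (proj₁ (proj₂ (isProduct x y)))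

    unique′ : ∀ {Q} {u v : Hom Q P} → p₁ ∘ u ≡ p₁ ∘ v → p₂ ∘ u ≡ p₂ ∘ v → u ≡ v
    unique′ {u = u} {v} e₁ e₂ =
      let (_ , _ , unique) = isProduct (p₁ ∘ v) (p₂ ∘ v)
      in trans (unique u (e₁ , e₂)) (sym (unique v (refl , refl)))

module CanonicalMaps {o h o' h'} {C : Category o h} {D : Displayed C o' h'} (K : CompData C D) where
  open Category C
  open Displayed D
  open CompData K

  χ-castᴰ : ∀ {Δ Γ} {σ σ′ : Hom Δ Γ} {X Y} (e : σ ≡ σ′) (f : Hom[ σ ] X Y) →
            χ (castᴰ e f) ≡ χ f
  χ-castᴰ refl f = refl

  module WithLaws (χ-∘ : ∀ {Θ Δ Γ} {σ : Hom Δ Γ} {τ : Hom Θ Δ} {X Y Z}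
                           (f : Hom[ σ ] Y Z) (g : Hom[ τ ] X Y) → χ (f ∘ᴰ g) ≡ χ f ∘ χ g)
                  (χ-lift∘factor : ∀ {Δ Γ} (A : Ob Γ) (σ : Hom Δ Γ) {Θ} {τ : Hom Θ Δ} {X : Ob Θ}
                                     (k : Hom[ σ ∘ τ ] X A) →
                                   χ (lift A σ) ∘ χ (factor A σ k) ≡ χ k)
    where

    χ-canon : ∀ {Δ Γ} (P A : Ob Γ) (σ : Hom Δ Γ) →
              χ (lift P (π A)) ∘ χ (canon K P A σ)
              ≡ χ (lift P σ) ∘ χ (lift (P [ σ ]) (π (A [ σ ])))
    χ-canon P A σ = trans (χ-lift∘factor _ _ _) (trans (χ-castᴰ _ _) (χ-∘ _ _))

    χ-reindexApp : ∀ {Δ Γ} {A P : Ob Γ} {B : Ob (ext Γ A)} (σ : Hom Δ Γ)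
                     (app : Hom[ id ] (P [ π A ]) B) →
                   χ (lift B (q K σ A)) ∘ χ (reindexApp K σ app) ≡ χ app ∘ χ (canon K P A σ)
    χ-reindexApp σ app = trans (χ-lift∘factor _ _ _) (trans (χ-castᴰ _ _) (χ-∘ _ _))

module Comprehension {o h o' h'} (𝒞 : FullCompCat o h o' h') where
  open FullCompCat 𝒞
  open Category C
  open CatNotions C
  open CategoryReasoning C
  open Limits C
  open Displayed T
  open CompData K
  open CompLaws K-laws

  χ-lift∘factor : ∀ {Δ Γ} (A : Ob Γ) (σ : Hom Δ Γ) {Θ} {τ : Hom Θ Δ} {X : Ob Θ}
                    (k : Hom[ σ ∘ τ ] X A) → χ (lift A σ) ∘ χ (factor A σ k) ≡ χ k
  χ-lift∘factor A σ k = trans (sym (χ-∘ _ _)) (cong χ (factor-comm A σ k))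

  χ-injective : ∀ {Δ Γ} {σ : Hom Δ Γ} {B A} {f g : Hom[ σ ] B A} → χ f ≡ χ g → f ≡ g
  χ-injective {f = f} {g} e =
    let (_ , _ , unique) = χ-fully-faithful (χ g) (χ-square g)
    in trans (unique f e) (sym (unique g refl))

  χ-vertical : ∀ {Γ} {X Y : Ob Γ} (f : Hom[ id ] X Y) → π Y ∘ χ f ≡ π X
  χ-vertical f = trans (χ-square f) identityˡ

  lift-cartesian : ∀ {Δ Γ} (X : Ob Γ) (σ : Hom Δ Γ) → IsCartesian (lift X σ)
  lift-cartesian X σ τ Y k = factor X σ k , factor-comm X σ k , λ g e → factor-unique X σ k g e

  lift-pullback : ∀ {Δ Γ} (X : Ob Γ) (σ : Hom Δ Γ) →
                  IsPullback (χ (lift X σ)) (π (X [ σ ])) (π X) σ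
  lift-pullback X σ = χ-cartesian (lift X σ) (lift-cartesian X σ)

  module _ {Δ Γ} (X : Ob Γ) (σ : Hom Δ Γ) where
    open Pullback (lift-pullback X σ) public
      renaming ( universal to pairᴿ ; p₁∘universal to χ∘pairᴿ ; p₂∘universal to π∘pairᴿ
               ; unique-diagram to pairᴿ-unique )

  open CanonicalMaps K public using (χ-castᴰ)
  open CanonicalMaps.WithLaws K χ-∘ χ-lift∘factor public using (χ-canon; χ-reindexApp)

  module Shriek-χ where
    open Shriek K using (Ob!; ⟦_⟧; K!)
    open CompData K! using () renaming (lift to lift!; factor to factor!)

    χ-lift!∘factor! : ∀ {Δ Γ} (A : Ob! Γ) (σ : Hom Δ Γ) {Θ} {τ : Hom Θ Δ} {X : Ob! Θ}
                        (k : Hom[ σ ∘ τ ] ⟦ X ⟧ ⟦ A ⟧) →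
                      χ (lift! A σ) ∘ χ (factor! A σ k) ≡ χ k
    χ-lift!∘factor! (V , E , n) σ k = pairᴿ-unique E n over-χ over-π
      where
        over-χ : χ (lift E n) ∘ (χ (lift! (V , E , n) σ) ∘ χ (factor! (V , E , n) σ k))
               ≡ χ (lift E n) ∘ χ k
        over-χ = begin
          χ (lift E n) ∘ (χ (lift! (V , E , n) σ) ∘ χ (factor! (V , E , n) σ k))
            ≡⟨ pullˡ (χ-lift∘factor _ _ _) ⟩
          χ (lift E (n ∘ σ)) ∘ χ (factor! (V , E , n) σ k)  ≡⟨ χ-lift∘factor _ _ _ ⟩
          χ (castᴰ _ (lift E n ∘ᴰ k))                       ≡⟨ χ-castᴰ _ _ ⟩
          χ (lift E n ∘ᴰ k)                                 ≡⟨ χ-∘ _ _ ⟩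
          χ (lift E n) ∘ χ k                                ∎
          where open ≡-Reasoning
        over-π : π (E [ n ]) ∘ (χ (lift! (V , E , n) σ) ∘ χ (factor! (V , E , n) σ k))
               ≡ π (E [ n ]) ∘ χ k
        over-π = trans (pullˡ (χ-square _))
                       (trans (pullʳ (χ-square _)) (trans (sym assoc) (sym (χ-square k))))

    open CanonicalMaps.WithLaws K! χ-∘ χ-lift!∘factor! public
      using () renaming (χ-canon to χ-canon!; χ-reindexApp to χ-reindexApp!)

module Classifiers {o h o' h'} (𝒞 : FullCompCat o h o' h') (lf : LF (FullCompCat.K 𝒞)) where
  open FullCompCat 𝒞
  open Category C
  open CatNotions C
  open CategoryReasoning C
  open Limits C
  open Displayed T
  open CompData K
  open Comprehension 𝒞

  -- V is the dependent exponential Π[χ(EA), pr₁] of the projection VA.EA × W → VA.EA, so a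
  -- map Γ → V over nA : Γ → VA amounts to a map Γ.EA[nA] → W.
  module PairClassifier {VA : Obj} (EA : Ob VA) (W : Obj) where
    opaque
      Pr : Obj
      Pr = proj₁ (proj₂ (proj₁ lf) (ext VA EA) W)
      pr₁ : Hom Pr (ext VA EA)
      pr₁ = proj₁ (proj₂ (proj₂ (proj₁ lf) (ext VA EA) W))
      pr₂ : Hom Pr W
      pr₂ = proj₁ (proj₂ (proj₂ (proj₂ (proj₁ lf) (ext VA EA) W)))
      Pr-isProduct : IsProduct pr₁ pr₂
      Pr-isProduct = proj₂ (proj₂ (proj₂ (proj₂ (proj₁ lf) (ext VA EA) W)))

    open Product Pr-isProduct

    opaque
      exponential : DepExp (π EA) pr₁
      exponential = proj₂ lf (π EA) pr₁ (one EA) (inj₂ (W , pr₂ , Pr-isProduct))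
      V : Obj
      V = proj₁ exponential
      e : Hom V VA
      e = proj₁ (proj₂ exponential)
      Ev : Obj
      Ev = proj₁ (proj₂ (proj₂ exponential))
      p : Hom Ev V
      p = proj₁ (proj₂ (proj₂ (proj₂ exponential)))
      f′ : Hom Ev (ext VA EA)
      f′ = proj₁ (proj₂ (proj₂ (proj₂ (proj₂ exponential))))
      Ev-pullback : IsPullback p f′ e (π EA)
      Ev-pullback = proj₁ (proj₂ (proj₂ (proj₂ (proj₂ (proj₂ exponential)))))
      ev : Hom Ev Pr
      ev = proj₁ (proj₂ (proj₂ (proj₂ (proj₂ (proj₂ (proj₂ exponential))))))
      pr₁∘ev : pr₁ ∘ ev ≡ f′
      pr₁∘ev = proj₁ (proj₂ (proj₂ (proj₂ (proj₂ (proj₂ (proj₂ (proj₂ exponential)))))))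
      ev-universal : ∀ {W′ Q} (w : Hom W′ VA) (q₁ : Hom Q W′) (q₂ : Hom Q (ext VA EA)) →
                     IsPullback q₁ q₂ w (π EA) → (k′ : Hom Q Pr) → pr₁ ∘ k′ ≡ q₂ →
                     Unique (λ (k : Hom W′ V) → (e ∘ k ≡ w) ×
                       (∀ (m : Hom Q Ev) → p ∘ m ≡ k ∘ q₁ → f′ ∘ m ≡ q₂ →
                          ev ∘ m ≡ k′))
      ev-universal = proj₂ (proj₂ (proj₂ (proj₂ (proj₂ (proj₂ (proj₂ (proj₂ exponential)))))))

    private module Ev = Pullback Ev-pullback

    pairEv : ∀ {Γ} (nA : Hom Γ VA) (m : Hom Γ V) → e ∘ m ≡ nA → Hom (ext Γ (EA [ nA ])) Ev
    pairEv nA m e∘m = Ev.universal (m ∘ π (EA [ nA ])) (χ (lift EA nA))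
                                   (trans (pullˡ e∘m) (sym (χ-square _)))

    comparison : ∀ {Γ} (nA : Hom Γ VA) (m : Hom Γ V) → e ∘ m ≡ nA →
                 Hom (ext Γ (EA [ nA ])) (ext V (EA [ e ]))
    comparison nA m e∘m = pairᴿ EA e (χ (lift EA nA)) (m ∘ π (EA [ nA ]))
                                (trans (χ-square _) (sym (pullˡ e∘m)))

    π∘comparison : ∀ {Γ} {nA : Hom Γ VA} {m : Hom Γ V} {e∘m : e ∘ m ≡ nA} →
                   π (EA [ e ]) ∘ comparison nA m e∘m ≡ m ∘ π (EA [ nA ])
    π∘comparison = π∘pairᴿ _ _

    χ∘comparison : ∀ {Γ} {nA : Hom Γ VA} {m : Hom Γ V} {e∘m : e ∘ m ≡ nA} →
                   χ (lift EA e) ∘ comparison nA m e∘m ≡ χ (lift EA nA)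
    χ∘comparison = χ∘pairᴿ _ _

    comparison-natural : ∀ {Γ Γ′} {nA′ : Hom Γ′ VA} {m′ : Hom Γ′ V}
                           {e∘m′ : e ∘ m′ ≡ nA′}
                           {nA : Hom Γ VA} {s : Hom Γ Γ′} {e∘m′s : e ∘ (m′ ∘ s) ≡ nA}
                           (ŝ : Hom (ext Γ (EA [ nA ])) (ext Γ′ (EA [ nA′ ]))) →
                         π (EA [ nA′ ]) ∘ ŝ ≡ s ∘ π (EA [ nA ]) →
                         χ (lift EA nA′) ∘ ŝ ≡ χ (lift EA nA) →
                         comparison nA′ m′ e∘m′ ∘ ŝ ≡ comparison nA (m′ ∘ s) e∘m′s
    comparison-natural ŝ π∘ŝ χ∘ŝ = pairᴿ-unique EA e
      (trans (pullˡ χ∘comparison) (trans χ∘ŝ (sym χ∘comparison)))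
      (trans (pullˡ π∘comparison) (trans (pullʳ π∘ŝ) (trans (sym assoc) (sym π∘comparison))))

    generic : Hom (ext V (EA [ e ])) W
    generic = pr₂ ∘ (ev ∘ pairEv e id identityʳ)

    private
      pairEv∘comparison : ∀ {Γ} {nA : Hom Γ VA} {m : Hom Γ V} {e∘m : e ∘ m ≡ nA} →
                          pairEv e id identityʳ ∘ comparison nA m e∘m ≡ pairEv nA m e∘m
      pairEv∘comparison = Ev.unique-diagram
        (trans (pullˡ Ev.p₁∘universal)
          (trans (identityˡ ⟩∘⟨refl) (trans π∘comparison (sym Ev.p₁∘universal))))
        (trans (pullˡ Ev.p₂∘universal) (trans χ∘comparison (sym Ev.p₂∘universal)))

      generic∘comparison-ev : ∀ {Γ} {nA : Hom Γ VA} {m : Hom Γ V} {e∘m : e ∘ m ≡ nA} →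
                              generic ∘ comparison nA m e∘m ≡ pr₂ ∘ (ev ∘ pairEv nA m e∘m)
      generic∘comparison-ev = pullʳ (pullʳ pairEv∘comparison)

      ev∘pairEv : ∀ {Γ} {nA : Hom Γ VA} {m : Hom Γ V} {e∘m : e ∘ m ≡ nA} →
                  ev ∘ pairEv nA m e∘m ≡ ⟨ χ (lift EA nA) , generic ∘ comparison nA m e∘m ⟩
      ev∘pairEv = unique′
        (trans (pullˡ pr₁∘ev) (trans Ev.p₂∘universal (sym project₁)))
        (trans (sym generic∘comparison-ev) (sym project₂))

      classifying : ∀ {Γ} (nA : Hom Γ VA) (nB : Hom (ext Γ (EA [ nA ])) W) →
                    Unique (λ (k : Hom Γ V) → (e ∘ k ≡ nA) ×
                      (∀ (m : Hom (ext Γ (EA [ nA ])) Ev) → p ∘ m ≡ k ∘ π (EA [ nA ]) →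
                         f′ ∘ m ≡ χ (lift EA nA) → ev ∘ m ≡ ⟨ χ (lift EA nA) , nB ⟩))
      classifying nA nB = ev-universal nA (π (EA [ nA ])) (χ (lift EA nA))
                            (IsPullback-swap (lift-pullback EA nA)) ⟨ χ (lift EA nA) , nB ⟩ project₁

    classify : ∀ {Γ} (nA : Hom Γ VA) → Hom (ext Γ (EA [ nA ])) W → Hom Γ V
    classify nA nB = proj₁ (classifying nA nB)

    e∘classify : ∀ {Γ} {nA : Hom Γ VA} {nB : Hom (ext Γ (EA [ nA ])) W} → e ∘ classify nA nB ≡ nA
    e∘classify {nA = nA} {nB} = proj₁ (proj₁ (proj₂ (classifying nA nB)))

    generic∘comparison : ∀ {Γ} {nA : Hom Γ VA} {nB : Hom (ext Γ (EA [ nA ])) W} →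
                         generic ∘ comparison nA (classify nA nB) e∘classify ≡ nB
    generic∘comparison {nA = nA} {nB} = begin
      generic ∘ comparison nA (classify nA nB) e∘classify       ≡⟨ generic∘comparison-ev ⟩
      pr₂ ∘ (ev ∘ pairEv nA (classify nA nB) e∘classify)        ≡⟨ refl⟩∘⟨ ev-classify ⟩
      pr₂ ∘ ⟨ χ (lift EA nA) , nB ⟩                             ≡⟨ project₂ ⟩
      nB                                                        ∎
      where
        open ≡-Reasoning
        ev-classify : ev ∘ pairEv nA (classify nA nB) e∘classify ≡ ⟨ χ (lift EA nA) , nB ⟩
        ev-classify = proj₂ (proj₁ (proj₂ (classifying nA nB))) _ Ev.p₁∘universal Ev.p₂∘universal

    classify-unique : ∀ {Γ} {nA : Hom Γ VA} {nB : Hom (ext Γ (EA [ nA ])) W} (k : Hom Γ V)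
                        (e∘k : e ∘ k ≡ nA) → generic ∘ comparison nA k e∘k ≡ nB →
                      k ≡ classify nA nB
    classify-unique {nA = nA} {nB} k e∘k classifies = proj₂ (proj₂ (classifying nA nB)) k (e∘k , ev-k)
      where
        ev-k : ∀ m → p ∘ m ≡ k ∘ π (EA [ nA ]) → f′ ∘ m ≡ χ (lift EA nA) →
               ev ∘ m ≡ ⟨ χ (lift EA nA) , nB ⟩
        ev-k m p∘m f′∘m = begin
          ev ∘ m                                          ≡⟨ refl⟩∘⟨ m≡pairEv ⟩
          ev ∘ pairEv nA k e∘k                            ≡⟨ ev∘pairEv ⟩
          ⟨ χ (lift EA nA) , generic ∘ comparison nA k e∘k ⟩
                                                          ≡⟨ cong ⟨ χ (lift EA nA) ,_⟩ classifies ⟩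
          ⟨ χ (lift EA nA) , nB ⟩                         ∎
          where
            open ≡-Reasoning
            m≡pairEv : m ≡ pairEv nA k e∘k
            m≡pairEv = Ev.unique-diagram (trans p∘m (sym Ev.p₁∘universal))
                                         (trans f′∘m (sym Ev.p₂∘universal))

    classify-natural : ∀ {Γ Γ′} {nA′ : Hom Γ′ VA} {nB′ : Hom (ext Γ′ (EA [ nA′ ])) W}
                         {nA : Hom Γ VA} {nB : Hom (ext Γ (EA [ nA ])) W} {s : Hom Γ Γ′}
                         (ŝ : Hom (ext Γ (EA [ nA ])) (ext Γ′ (EA [ nA′ ]))) →
                       nA′ ∘ s ≡ nA → π (EA [ nA′ ]) ∘ ŝ ≡ s ∘ π (EA [ nA ]) →
                       χ (lift EA nA′) ∘ ŝ ≡ χ (lift EA nA) → nB′ ∘ ŝ ≡ nB →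
                       classify nA′ nB′ ∘ s ≡ classify nA nB
    classify-natural {nA′ = nA′} {nB′} {nA} {s = s} ŝ nA′∘s π∘ŝ χ∘ŝ nB′∘ŝ =
      classify-unique _ e∘classify∘s
        (trans (refl⟩∘⟨ sym (comparison-natural ŝ π∘ŝ χ∘ŝ))
               (trans (pullˡ generic∘comparison) nB′∘ŝ))
      where
        e∘classify∘s : e ∘ (classify nA′ nB′ ∘ s) ≡ nA
        e∘classify∘s = trans (sym assoc) (trans (e∘classify ⟩∘⟨refl) nA′∘s)

    generic-natural : ∀ {Γ Q} {nA : Hom Γ VA} {nB : Hom (ext Γ (EA [ nA ])) W}
                        (β : Hom Q (ext V (EA [ e ]))) (γ : Hom Q (ext Γ (EA [ nA ]))) →
                      π (EA [ e ]) ∘ β ≡ classify nA nB ∘ (π (EA [ nA ]) ∘ γ) →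
                      χ (lift EA e) ∘ β ≡ χ (lift EA nA) ∘ γ → generic ∘ β ≡ nB ∘ γ
    generic-natural {nA = nA} {nB} β γ π∘β χ∘β =
      trans (refl⟩∘⟨ β≡comparison∘γ) (pullˡ generic∘comparison)
      where
        β≡comparison∘γ : β ≡ comparison nA (classify nA nB) e∘classify ∘ γ
        β≡comparison∘γ = pairᴿ-unique EA e
          (trans χ∘β (sym (pullˡ χ∘comparison)))
          (trans π∘β (trans (sym assoc) (sym (pullˡ π∘comparison))))

module DependentProducts {o h o' h'} (𝒞 : FullCompCat o h o' h')
         (lf : LF (FullCompCat.K 𝒞)) (wdp : WeakDepProducts (FullCompCat.K 𝒞)) where
  open FullCompCat 𝒞
  open Category C
  open CategoryReasoning C
  open Displayed T
  open CompData K
  open CompLaws K-laws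
  open Comprehension 𝒞
  open Shriek-χ
  open Classifiers 𝒞 lf

  module Generic {VA : Obj} (EA : Ob VA) {VB : Obj} (EB : Ob VB) where
    module Fam = PairClassifier EA VB
    module Tm = PairClassifier EA (ext VB EB)
    open Fam using (V; e; generic)

    Agen : Ob V
    Agen = EA [ e ]

    Bgen : Ob (ext V Agen)
    Bgen = EB [ generic ]

    opaque
      Πgen : Ob V
      Πgen = proj₁ (wdp Agen Bgen)

      appgen : Hom[ id ] (Πgen [ π Agen ]) Bgen
      appgen = proj₁ (proj₂ (wdp Agen Bgen))

      Πgen-weakly-stable : ∀ {Δ} (σ : Hom Δ V) →
        Σ[ lam ∈ (Section K (Bgen [ q K σ Agen ]) → Section K (Πgen [ σ ])) ]
          IsDepProd K (Agen [ σ ]) (Bgen [ q K σ Agen ]) (Πgen [ σ ]) (reindexApp K σ appgen) lam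
      Πgen-weakly-stable = proj₂ (proj₂ (wdp Agen Bgen))

    -- A point of Tm.V is a type-family together with a term of it; typeOf forgets the term.
    typeOf : Hom Tm.V V
    typeOf = Fam.classify Tm.e (π EB ∘ Tm.generic)

    Agenᵗ : Ob Tm.V
    Agenᵗ = Agen [ typeOf ]

    qᵗ : Hom (ext Tm.V Agenᵗ) (ext V Agen)
    qᵗ = q K typeOf Agen

    ψ : Hom (ext Tm.V Agenᵗ) (ext Tm.V (EA [ Tm.e ]))
    ψ = pairᴿ EA Tm.e (χ (lift EA e) ∘ qᵗ) (π Agenᵗ)
              (trans (pullˡ (χ-square _))
                (trans (pullʳ (χ-square _)) (trans (sym assoc) (Fam.e∘classify ⟩∘⟨refl))))

    generic∘qᵗ : generic ∘ qᵗ ≡ (π EB ∘ Tm.generic) ∘ ψ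
    generic∘qᵗ = Fam.generic-natural qᵗ ψ
      (trans (χ-square _) (refl⟩∘⟨ sym (π∘pairᴿ _ _)))
      (sym (χ∘pairᴿ _ _))

    private
      genericTermᴳ : Hom (ext Tm.V Agenᵗ) (ext (ext V Agen) Bgen)
      genericTermᴳ = pairᴿ EB generic (Tm.generic ∘ ψ) qᵗ (trans (sym assoc) (sym generic∘qᵗ))

    genericTerm : Section K (Bgen [ qᵗ ])
    genericTerm = pairᴿ Bgen qᵗ genericTermᴳ id (trans (π∘pairᴿ _ _) (sym identityʳ))
                , π∘pairᴿ _ _

    χ∘genericTerm : χ (lift EB generic) ∘ (χ (lift Bgen qᵗ) ∘ proj₁ genericTerm)
                    ≡ Tm.generic ∘ ψ
    χ∘genericTerm = trans (refl⟩∘⟨ χ∘pairᴿ _ _) (χ∘pairᴿ _ _)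

    genericLam : Section K (Πgen [ typeOf ])
    genericLam = proj₁ (Πgen-weakly-stable typeOf) genericTerm

    lamPoint : Hom (ext Tm.V Agenᵗ) (ext (ext Tm.V Agenᵗ) ((Πgen [ typeOf ]) [ π Agenᵗ ]))
    lamPoint = pairᴿ (Πgen [ typeOf ]) (π Agenᵗ) (proj₁ genericLam ∘ π Agenᵗ) id
                     (trans (pullˡ (proj₂ genericLam)) (trans identityˡ (sym identityʳ)))

    lamPointᴳ : Hom (ext Tm.V Agenᵗ) (ext (ext V Agen) (Πgen [ π Agen ]))
    lamPointᴳ = χ (canon K Πgen Agen typeOf) ∘ lamPoint

    π∘lamPointᴳ : π (Πgen [ π Agen ]) ∘ lamPointᴳ ≡ qᵗ
    π∘lamPointᴳ = trans (pullˡ (χ-square _)) (trans (pullʳ (π∘pairᴿ _ _)) identityʳ)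

    χ∘lamPointᴳ : χ (lift Πgen (π Agen)) ∘ lamPointᴳ
                  ≡ χ (lift Πgen typeOf) ∘ (proj₁ genericLam ∘ π Agenᵗ)
    χ∘lamPointᴳ = trans (pullˡ (χ-canon _ _ _)) (pullʳ (χ∘pairᴿ _ _))

    appgen∘lamPointᴳ : χ (lift EB generic) ∘ (χ appgen ∘ lamPointᴳ) ≡ Tm.generic ∘ ψ
    appgen∘lamPointᴳ = begin
      χ (lift EB generic) ∘ (χ appgen ∘ (χ (canon K Πgen Agen typeOf) ∘ lamPoint))
        ≡⟨ refl⟩∘⟨ sym assoc ⟩
      χ (lift EB generic) ∘ ((χ appgen ∘ χ (canon K Πgen Agen typeOf)) ∘ lamPoint)
        ≡⟨ refl⟩∘⟨ (sym (χ-reindexApp typeOf appgen) ⟩∘⟨refl) ⟩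
      χ (lift EB generic) ∘ ((χ (lift Bgen qᵗ) ∘ χ (reindexApp K typeOf appgen)) ∘ lamPoint)
        ≡⟨ refl⟩∘⟨ pullʳ app∘lamPoint ⟩
      χ (lift EB generic) ∘ (χ (lift Bgen qᵗ) ∘ proj₁ genericTerm)
        ≡⟨ χ∘genericTerm ⟩
      Tm.generic ∘ ψ ∎
      where
        open ≡-Reasoning
        app∘lamPoint : χ (reindexApp K typeOf appgen) ∘ lamPoint ≡ proj₁ genericTerm
        app∘lamPoint = proj₂ (Πgen-weakly-stable typeOf) genericTerm lamPoint
                             (π∘pairᴿ _ _) (χ∘pairᴿ _ _)

    module _ {Γ} (nA : Hom Γ VA) where
      πA : Hom (ext Γ (EA [ nA ])) Γ
      πA = π (EA [ nA ])

      comparisonᴾ : (m : Hom Γ V) → e ∘ m ≡ nA →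
                    Hom (ext (ext Γ (EA [ nA ])) (Πgen [ m ∘ πA ])) (ext (ext V Agen) (Πgen [ π Agen ]))
      comparisonᴾ m e∘m = pairᴿ Πgen (π Agen) (χ (lift Πgen (m ∘ πA)))
                                (Fam.comparison nA m e∘m ∘ π (Πgen [ m ∘ πA ]))
                                (trans (χ-square _) (sym (pullˡ Fam.π∘comparison)))

      module _ (nB : Hom (ext Γ (EA [ nA ])) VB) (m : Hom Γ V) (e∘m : e ∘ m ≡ nA)
               (generic∘comparison : generic ∘ Fam.comparison nA m e∘m ≡ nB) where
        appMap : Hom (ext (ext Γ (EA [ nA ])) (Πgen [ m ∘ πA ])) (ext (ext Γ (EA [ nA ])) (EB [ nB ]))
        appMap = pairᴿ EB nB (χ (lift EB generic) ∘ (χ appgen ∘ comparisonᴾ m e∘m))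
                             (π (Πgen [ m ∘ πA ])) square
          where
            square : π EB ∘ (χ (lift EB generic) ∘ (χ appgen ∘ comparisonᴾ m e∘m))
                     ≡ nB ∘ π (Πgen [ m ∘ πA ])
            square = begin
              π EB ∘ (χ (lift EB generic) ∘ (χ appgen ∘ comparisonᴾ m e∘m))
                ≡⟨ pullˡ (χ-square _) ⟩
              (generic ∘ π Bgen) ∘ (χ appgen ∘ comparisonᴾ m e∘m)
                ≡⟨ pullʳ (pullˡ (χ-vertical appgen)) ⟩
              generic ∘ (π (Πgen [ π Agen ]) ∘ comparisonᴾ m e∘m)
                ≡⟨ refl⟩∘⟨ π∘pairᴿ _ _ ⟩
              generic ∘ (Fam.comparison nA m e∘m ∘ π (Πgen [ m ∘ πA ]))
                ≡⟨ sym assoc ⟩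
              (generic ∘ Fam.comparison nA m e∘m) ∘ π (Πgen [ m ∘ πA ])
                ≡⟨ generic∘comparison ⟩∘⟨refl ⟩
              nB ∘ π (Πgen [ m ∘ πA ]) ∎
              where open ≡-Reasoning

        appMap-vertical : π (EB [ nB ]) ∘ appMap ≡ id ∘ π (Πgen [ m ∘ πA ])
        appMap-vertical = trans (π∘pairᴿ _ _) (sym identityˡ)

    appMap-irrelevant : ∀ {Γ} {nA : Hom Γ VA} {nB : Hom (ext Γ (EA [ nA ])) VB} {m : Hom Γ V}
                          {e∘m₁ e∘m₂ : e ∘ m ≡ nA}
                          (g₁ : generic ∘ Fam.comparison nA m e∘m₁ ≡ nB)
                          (g₂ : generic ∘ Fam.comparison nA m e∘m₂ ≡ nB) →
                        appMap nA nB m e∘m₁ g₁ ≡ appMap nA nB m e∘m₂ g₂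
    appMap-irrelevant {e∘m₁ = e∘m₁} {e∘m₂} = irrelevant (uip e∘m₁ e∘m₂)
      where
        irrelevant : ∀ {e∘m₂} → e∘m₁ ≡ e∘m₂ → ∀ g₁ g₂ →
                     appMap _ _ _ e∘m₁ g₁ ≡ appMap _ _ _ e∘m₂ g₂
        irrelevant refl g₁ g₂ = cong (appMap _ _ _ e∘m₁) (uip g₁ g₂)

    app-transport : ∀ {Δ} {nA : Hom Δ VA} {nB : Hom (ext Δ (EA [ nA ])) VB} {m₁ m₂ : Hom Δ V}
                      (m₁≡m₂ : m₁ ≡ m₂) {e∘m₁ : e ∘ m₁ ≡ nA} {e∘m₂ : e ∘ m₂ ≡ nA}
                      {g₁ : generic ∘ Fam.comparison nA m₁ e∘m₁ ≡ nB}
                      {g₂ : generic ∘ Fam.comparison nA m₂ e∘m₂ ≡ nB}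
                      (x : Hom[ id ] (Πgen [ m₁ ∘ πA nA ]) (EB [ nB ]))
                      (y : Hom[ id ] (Πgen [ m₂ ∘ πA nA ]) (EB [ nB ])) →
                    χ x ≡ appMap nA nB m₁ e∘m₁ g₁ → χ y ≡ appMap nA nB m₂ e∘m₂ g₂ →
                    subst (λ m → Hom[ id ] (Πgen [ m ∘ πA nA ]) (EB [ nB ])) m₁≡m₂ x ≡ y
    app-transport refl {g₁ = g₁} {g₂} x y χx χy =
      χ-injective (trans χx (trans (appMap-irrelevant g₁ g₂) (sym χy)))

    section-transport : ∀ {Δ} {m₁ m₂ : Hom Δ V} (m₁≡m₂ : m₁ ≡ m₂)
                          (x : Section K (Πgen [ m₁ ])) (y : Section K (Πgen [ m₂ ])) →
                        χ (lift Πgen m₁) ∘ proj₁ x ≡ χ (lift Πgen m₂) ∘ proj₁ y →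
                        subst (λ m → Hom Δ (ext Δ (Πgen [ m ]))) m₁≡m₂ (proj₁ x) ≡ proj₁ y
    section-transport {m₁ = m₁} refl (x , πx) (y , πy) χx≡χy =
      pairᴿ-unique Πgen m₁ χx≡χy (trans πx (sym πy))

    module Stage {Γ} (nA : Hom Γ VA) (nB : Hom (ext Γ (EA [ nA ])) VB) where
      n : Hom Γ V
      n = Fam.classify nA nB

      comparisonₙ : Hom (ext Γ (EA [ nA ])) (ext V Agen)
      comparisonₙ = Fam.comparison nA n Fam.e∘classify

      comparisonᴾₙ : Hom (ext (ext Γ (EA [ nA ])) (Πgen [ n ∘ πA nA ]))
                         (ext (ext V Agen) (Πgen [ π Agen ]))
      comparisonᴾₙ = comparisonᴾ nA n Fam.e∘classify

      appMapₙ : Hom (ext (ext Γ (EA [ nA ])) (Πgen [ n ∘ πA nA ]))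
                    (ext (ext Γ (EA [ nA ])) (EB [ nB ]))
      appMapₙ = appMap nA nB n Fam.e∘classify Fam.generic∘comparison

      opaque
        app : Hom[ id ] (Πgen [ n ∘ πA nA ]) (EB [ nB ])
        app = proj₁ (χ-fully-faithful appMapₙ (appMap-vertical _ _ _ _ _))

        χ-app : χ app ≡ appMapₙ
        χ-app = proj₁ (proj₂ (χ-fully-faithful appMapₙ (appMap-vertical _ _ _ _ _)))

      module _ (t : Section K (EB [ nB ])) where
        t̃ : Hom (ext Γ (EA [ nA ])) (ext VB EB)
        t̃ = χ (lift EB nB) ∘ proj₁ t

        termCode : Hom Γ Tm.V
        termCode = Tm.classify nA t̃

        typeOf∘termCode : typeOf ∘ termCode ≡ n
        typeOf∘termCode = Fam.classify-natural (Tm.comparison nA termCode Tm.e∘classify)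
          Tm.e∘classify Tm.π∘comparison Tm.χ∘comparison
          (trans (pullʳ Tm.generic∘comparison)
            (trans (pullˡ (χ-square _)) (trans (pullʳ (proj₂ t)) identityʳ)))

        lamᴳ : Hom Γ (ext V Πgen)
        lamᴳ = χ (lift Πgen typeOf) ∘ (proj₁ genericLam ∘ termCode)

        opaque
          lam : Section K (Πgen [ n ])
          lam = pairᴿ Πgen n lamᴳ id square , π∘pairᴿ _ _
            where
              square : π Πgen ∘ lamᴳ ≡ n ∘ id
              square = trans (pullˡ (χ-square _))
                (trans (pullʳ (pullˡ (proj₂ genericLam)))
                  (trans (refl⟩∘⟨ identityˡ) (trans typeOf∘termCode (sym identityʳ))))

          χ-lam : χ (lift Πgen n) ∘ proj₁ lam ≡ lamᴳ
          χ-lam = χ∘pairᴿ _ _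

        γ : Hom (ext Γ (EA [ nA ])) (ext Tm.V Agenᵗ)
        γ = pairᴿ Agen typeOf comparisonₙ (termCode ∘ πA nA)
              (trans Fam.π∘comparison (trans (sym typeOf∘termCode ⟩∘⟨refl) assoc))

        generic∘ψ∘γ : Tm.generic ∘ (ψ ∘ γ) ≡ t̃
        generic∘ψ∘γ = trans (Tm.generic-natural (ψ ∘ γ) id
          (trans (pullˡ (π∘pairᴿ _ _)) (trans (π∘pairᴿ _ _) (refl⟩∘⟨ sym identityʳ)))
          (trans (pullˡ (χ∘pairᴿ _ _))
            (trans (pullʳ (χ∘pairᴿ _ _)) (trans Fam.χ∘comparison (sym identityʳ)))))
          identityʳ

        module _ (u : Hom (ext Γ (EA [ nA ])) (ext (ext Γ (EA [ nA ])) (Πgen [ n ∘ πA nA ])))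
                 (π∘u : π (Πgen [ n ∘ πA nA ]) ∘ u ≡ id)
                 (χ∘u : χ (factor Πgen n (lift Πgen (n ∘ πA nA))) ∘ u ≡ proj₁ lam ∘ πA nA)
                 where
          comparisonᴾ∘u : comparisonᴾₙ ∘ u ≡ lamPointᴳ ∘ γ
          comparisonᴾ∘u = pairᴿ-unique Πgen (π Agen) over-χ over-π
            where
              open ≡-Reasoning
              over-χ : χ (lift Πgen (π Agen)) ∘ (comparisonᴾₙ ∘ u)
                     ≡ χ (lift Πgen (π Agen)) ∘ (lamPointᴳ ∘ γ)
              over-χ = begin
                χ (lift Πgen (π Agen)) ∘ (comparisonᴾₙ ∘ u)
                  ≡⟨ pullˡ (χ∘pairᴿ _ _) ⟩
                χ (lift Πgen (n ∘ πA nA)) ∘ u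
                  ≡⟨ sym (χ-lift∘factor _ _ _) ⟩∘⟨refl ⟩
                (χ (lift Πgen n) ∘ χ (factor Πgen n (lift Πgen (n ∘ πA nA)))) ∘ u
                  ≡⟨ pullʳ χ∘u ⟩
                χ (lift Πgen n) ∘ (proj₁ lam ∘ πA nA)
                  ≡⟨ pullˡ χ-lam ⟩
                lamᴳ ∘ πA nA
                  ≡⟨ pullʳ (pullʳ (sym (π∘pairᴿ _ _))) ⟩
                χ (lift Πgen typeOf) ∘ (proj₁ genericLam ∘ (π Agenᵗ ∘ γ))
                  ≡⟨ trans (refl⟩∘⟨ sym assoc) (sym assoc) ⟩
                (χ (lift Πgen typeOf) ∘ (proj₁ genericLam ∘ π Agenᵗ)) ∘ γ
                  ≡⟨ sym (pullˡ χ∘lamPointᴳ) ⟩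
                χ (lift Πgen (π Agen)) ∘ (lamPointᴳ ∘ γ) ∎
              over-π : π (Πgen [ π Agen ]) ∘ (comparisonᴾₙ ∘ u)
                     ≡ π (Πgen [ π Agen ]) ∘ (lamPointᴳ ∘ γ)
              over-π = begin
                π (Πgen [ π Agen ]) ∘ (comparisonᴾₙ ∘ u)        ≡⟨ pullˡ (π∘pairᴿ _ _) ⟩
                (comparisonₙ ∘ π (Πgen [ n ∘ πA nA ])) ∘ u      ≡⟨ pullʳ π∘u ⟩
                comparisonₙ ∘ id                                ≡⟨ identityʳ ⟩
                comparisonₙ                                     ≡⟨ sym (χ∘pairᴿ _ _) ⟩
                qᵗ ∘ γ                                          ≡⟨ sym (pullˡ π∘lamPointᴳ) ⟩
                π (Πgen [ π Agen ]) ∘ (lamPointᴳ ∘ γ)           ∎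

          isDepProd : χ app ∘ u ≡ proj₁ t
          isDepProd = trans (χ-app ⟩∘⟨refl) (pairᴿ-unique EB nB over-χ over-π)
            where
              open ≡-Reasoning
              over-χ : χ (lift EB nB) ∘ (appMapₙ ∘ u) ≡ χ (lift EB nB) ∘ proj₁ t
              over-χ = begin
                χ (lift EB nB) ∘ (appMapₙ ∘ u)
                  ≡⟨ pullˡ (χ∘pairᴿ _ _) ⟩
                (χ (lift EB generic) ∘ (χ appgen ∘ comparisonᴾₙ)) ∘ u
                  ≡⟨ pullʳ (pullʳ comparisonᴾ∘u) ⟩
                χ (lift EB generic) ∘ (χ appgen ∘ (lamPointᴳ ∘ γ))
                  ≡⟨ refl⟩∘⟨ sym assoc ⟩
                χ (lift EB generic) ∘ ((χ appgen ∘ lamPointᴳ) ∘ γ)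
                  ≡⟨ pullˡ appgen∘lamPointᴳ ⟩
                (Tm.generic ∘ ψ) ∘ γ
                  ≡⟨ trans assoc generic∘ψ∘γ ⟩
                χ (lift EB nB) ∘ proj₁ t ∎
              over-π : π (EB [ nB ]) ∘ (appMapₙ ∘ u) ≡ π (EB [ nB ]) ∘ proj₁ t
              over-π = trans (pullˡ (π∘pairᴿ _ _)) (trans π∘u (sym (proj₂ t)))

    module Stability {Δ Γ} (σ : Hom Δ Γ) (nA : Hom Γ VA) (nB : Hom (ext Γ (EA [ nA ])) VB) where
      open Shriek K using (K!)
      open CompData K! using () renaming (lift to lift!)

      qσ : Hom (ext Δ (EA [ nA ∘ σ ])) (ext Γ (EA [ nA ]))
      qσ = q K! σ (VA , EA , nA)

      π∘qσ : π (EA [ nA ]) ∘ qσ ≡ σ ∘ π (EA [ nA ∘ σ ])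
      π∘qσ = χ-square _

      χ∘qσ : χ (lift EA nA) ∘ qσ ≡ χ (lift EA (nA ∘ σ))
      χ∘qσ = χ-lift∘factor _ _ _

      module S₀ = Stage nA nB
      module S₁ = Stage (nA ∘ σ) (nB ∘ qσ)

      classify-stable : S₀.n ∘ σ ≡ S₁.n
      classify-stable = Fam.classify-natural qσ refl π∘qσ χ∘qσ refl

      e∘nσ : e ∘ (S₀.n ∘ σ) ≡ nA ∘ σ
      e∘nσ = trans (sym assoc) (Fam.e∘classify ⟩∘⟨refl)

      comparison-stable : S₀.comparisonₙ ∘ qσ ≡ Fam.comparison (nA ∘ σ) (S₀.n ∘ σ) e∘nσ
      comparison-stable = Fam.comparison-natural qσ π∘qσ χ∘qσ

      generic∘comparison-stable : generic ∘ Fam.comparison (nA ∘ σ) (S₀.n ∘ σ) e∘nσ ≡ nB ∘ qσ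
      generic∘comparison-stable =
        trans (refl⟩∘⟨ sym comparison-stable) (pullˡ Fam.generic∘comparison)

      appMapσ : Hom (ext (ext Δ (EA [ nA ∘ σ ])) (Πgen [ (S₀.n ∘ σ) ∘ πA (nA ∘ σ) ]))
                    (ext (ext Δ (EA [ nA ∘ σ ])) (EB [ nB ∘ qσ ]))
      appMapσ = appMap (nA ∘ σ) (nB ∘ qσ) (S₀.n ∘ σ) e∘nσ generic∘comparison-stable

      canonσ : Hom[ qσ ] (Πgen [ (S₀.n ∘ σ) ∘ πA (nA ∘ σ) ]) (Πgen [ S₀.n ∘ πA nA ])
      canonσ = canon K! (V , Πgen , S₀.n) (VA , EA , nA) σ

      χ-canonσ : χ (lift Πgen (S₀.n ∘ πA nA)) ∘ χ canonσ
                 ≡ χ (lift Πgen ((S₀.n ∘ σ) ∘ πA (nA ∘ σ)))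
      χ-canonσ = begin
        χ (lift Πgen (S₀.n ∘ πA nA)) ∘ χ canonσ
          ≡⟨ sym (χ-lift∘factor _ _ _) ⟩∘⟨refl ⟩
        (χ (lift Πgen S₀.n) ∘ χ (lift! (V , Πgen , S₀.n) (πA nA))) ∘ χ canonσ
          ≡⟨ pullʳ (χ-canon! _ _ _) ⟩
        χ (lift Πgen S₀.n) ∘ (χ (lift! (V , Πgen , S₀.n) σ)
                              ∘ χ (lift! (V , Πgen , S₀.n ∘ σ) (πA (nA ∘ σ))))
          ≡⟨ pullˡ (χ-lift∘factor _ _ _) ⟩
        χ (lift Πgen (S₀.n ∘ σ)) ∘ χ (lift! (V , Πgen , S₀.n ∘ σ) (πA (nA ∘ σ)))
          ≡⟨ χ-lift∘factor _ _ _ ⟩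
        χ (lift Πgen ((S₀.n ∘ σ) ∘ πA (nA ∘ σ))) ∎
        where open ≡-Reasoning

      comparisonᴾ-stable : S₀.comparisonᴾₙ ∘ χ canonσ
                           ≡ comparisonᴾ (nA ∘ σ) (S₀.n ∘ σ) e∘nσ
      comparisonᴾ-stable = pairᴿ-unique Πgen (π Agen)
        (trans (pullˡ (χ∘pairᴿ _ _)) (trans χ-canonσ (sym (χ∘pairᴿ _ _))))
        (trans (pullˡ (π∘pairᴿ _ _))
          (trans (pullʳ (χ-square _))
            (trans (sym assoc) (trans (comparison-stable ⟩∘⟨refl) (sym (π∘pairᴿ _ _))))))

      appMap-stable : χ (reindexApp K! σ S₀.app) ≡ appMapσ
      appMap-stable = pairᴿ-unique EB (nB ∘ qσ) over-χ (trans (χ-vertical _) (sym (π∘pairᴿ _ _)))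
        where
          open ≡-Reasoning
          over-χ : χ (lift EB (nB ∘ qσ)) ∘ χ (reindexApp K! σ S₀.app)
                 ≡ χ (lift EB (nB ∘ qσ)) ∘ appMapσ
          over-χ = begin
            χ (lift EB (nB ∘ qσ)) ∘ χ (reindexApp K! σ S₀.app)
              ≡⟨ sym (χ-lift∘factor _ _ _) ⟩∘⟨refl ⟩
            (χ (lift EB nB) ∘ χ (lift! (VB , EB , nB) qσ)) ∘ χ (reindexApp K! σ S₀.app)
              ≡⟨ pullʳ (χ-reindexApp! σ S₀.app) ⟩
            χ (lift EB nB) ∘ (χ S₀.app ∘ χ canonσ)
              ≡⟨ refl⟩∘⟨ (S₀.χ-app ⟩∘⟨refl) ⟩
            χ (lift EB nB) ∘ (S₀.appMapₙ ∘ χ canonσ)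
              ≡⟨ pullˡ (χ∘pairᴿ _ _) ⟩
            (χ (lift EB generic) ∘ (χ appgen ∘ S₀.comparisonᴾₙ)) ∘ χ canonσ
              ≡⟨ pullʳ (pullʳ comparisonᴾ-stable) ⟩
            χ (lift EB generic) ∘ (χ appgen ∘ comparisonᴾ (nA ∘ σ) (S₀.n ∘ σ) e∘nσ)
              ≡⟨ sym (χ∘pairᴿ _ _) ⟩
            χ (lift EB (nB ∘ qσ)) ∘ appMapσ ∎

      app-stable : subst (λ m → Hom[ id ] (Πgen [ m ∘ πA (nA ∘ σ) ]) (EB [ nB ∘ qσ ]))
                         classify-stable (reindexApp K! σ S₀.app)
                   ≡ S₁.app
      app-stable = app-transport classify-stable _ _ appMap-stable S₁.χ-app

      lam-stable : (t : Section K (EB [ nB ])) (u : Section K (EB [ nB ∘ qσ ]))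
                   (v : Section K (Πgen [ S₀.n ∘ σ ])) →
                   χ (lift! (VB , EB , nB) qσ) ∘ proj₁ u ≡ proj₁ t ∘ qσ →
                   χ (lift! (V , Πgen , S₀.n) σ) ∘ proj₁ v ≡ proj₁ (S₀.lam t) ∘ σ →
                   subst (λ m → Hom Δ (ext Δ (Πgen [ m ]))) classify-stable (proj₁ v)
                   ≡ proj₁ (S₁.lam u)
      lam-stable t u v u-reindexes-t v-reindexes-lam =
        section-transport classify-stable v (S₁.lam u) (begin
          χ (lift Πgen (S₀.n ∘ σ)) ∘ proj₁ v
            ≡⟨ sym (χ-lift∘factor _ _ _) ⟩∘⟨refl ⟩
          (χ (lift Πgen S₀.n) ∘ χ (lift! (V , Πgen , S₀.n) σ)) ∘ proj₁ v
            ≡⟨ pullʳ v-reindexes-lam ⟩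
          χ (lift Πgen S₀.n) ∘ (proj₁ (S₀.lam t) ∘ σ)
            ≡⟨ pullˡ (S₀.χ-lam t) ⟩
          S₀.lamᴳ t ∘ σ
            ≡⟨ pullʳ (pullʳ termCode-stable) ⟩
          S₁.lamᴳ u
            ≡⟨ sym (S₁.χ-lam u) ⟩
          χ (lift Πgen S₁.n) ∘ proj₁ (S₁.lam u) ∎)
        where
          open ≡-Reasoning
          t̃-stable : S₀.t̃ t ∘ qσ ≡ S₁.t̃ u
          t̃-stable = trans (pullʳ (sym u-reindexes-t)) (pullˡ (χ-lift∘factor _ _ _))
          termCode-stable : S₀.termCode t ∘ σ ≡ S₁.termCode u
          termCode-stable = Tm.classify-natural qσ refl π∘qσ χ∘qσ t̃-stable

  open Shriek K using (Ob!; ⟦_⟧; D!; K!)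
  open Generic using (Πgen; module Fam; module Stage; module Stability)
  private
    module D! = Displayed D!
    module K! = CompData K!
  open K! using () renaming (_[_] to _K![_])

  Π! : ∀ {Γ} (A : Ob! Γ) → Ob! (ext Γ ⟦ A ⟧) → Ob! Γ
  Π! (VA , EA , nA) (VB , EB , nB) = Fam.V EA EB , Πgen EA EB , Stage.n EA EB nA nB

  app! : ∀ {Γ} (A : Ob! Γ) (B : Ob! (ext Γ ⟦ A ⟧)) → D!.Hom[ id ] (Π! A B K![ K!.π A ]) B
  app! (VA , EA , nA) (VB , EB , nB) = Stage.app EA EB nA nB

  lam! : ∀ {Γ} (A : Ob! Γ) (B : Ob! (ext Γ ⟦ A ⟧)) → Section K! B → Section K! (Π! A B)
  lam! (VA , EA , nA) (VB , EB , nB) = Stage.lam EA EB nA nB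

  isDepProd! : ∀ {Γ} (A : Ob! Γ) (B : Ob! (ext Γ ⟦ A ⟧)) →
               IsDepProd K! A B (Π! A B) (app! A B) (lam! A B)
  isDepProd! (VA , EA , nA) (VB , EB , nB) = Stage.isDepProd EA EB nA nB

  Π!-stable : ∀ {Δ Γ} (A : Ob! Γ) (B : Ob! (ext Γ ⟦ A ⟧)) (σ : Hom Δ Γ) →
              Π! A B K![ σ ] ≡ Π! (A K![ σ ]) (B K![ q K! σ A ])
  Π!-stable (VA , EA , nA) (VB , EB , nB) σ =
    cong (λ m → Fam.V EA EB , Πgen EA EB , m) (Stability.classify-stable EA EB σ nA nB)

  app!-stable : ∀ {Δ Γ} (A : Ob! Γ) (B : Ob! (ext Γ ⟦ A ⟧)) (σ : Hom Δ Γ) →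
                subst (λ X → D!.Hom[ id ] (X K![ K!.π (A K![ σ ]) ]) (B K![ q K! σ A ]))
                      (Π!-stable A B σ) (reindexApp K! σ (app! A B))
                ≡ app! (A K![ σ ]) (B K![ q K! σ A ])
  app!-stable (VA , EA , nA) (VB , EB , nB) σ =
    trans (sym (subst-∘ (Stability.classify-stable EA EB σ nA nB)))
          (Stability.app-stable EA EB σ nA nB)

  lam!-stable : ∀ {Δ Γ} (A : Ob! Γ) (B : Ob! (ext Γ ⟦ A ⟧)) (σ : Hom Δ Γ)
                  (t : Section K! B) (u : Section K! (B K![ q K! σ A ]))
                  (v : Section K! (Π! A B K![ σ ])) →
                χ (K!.lift B (q K! σ A)) ∘ proj₁ u ≡ proj₁ t ∘ q K! σ A →
                χ (K!.lift (Π! A B) σ) ∘ proj₁ v ≡ proj₁ (lam! A B t) ∘ σ →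
                subst (λ X → Hom Δ (ext Δ ⟦ X ⟧)) (Π!-stable A B σ) (proj₁ v)
                ≡ proj₁ (lam! (A K![ σ ]) (B K![ q K! σ A ]) u)
  lam!-stable (VA , EA , nA) (VB , EB , nB) σ t u v u-reindexes-t v-reindexes-lam =
    trans (sym (subst-∘ (Stability.classify-stable EA EB σ nA nB)))
          (Stability.lam-stable EA EB σ nA nB t u v u-reindexes-t v-reindexes-lam)

  strictDepProducts : StrictDepProducts K!
  strictDepProducts = record
    { Πᶜ = Π!
    ; app = app!
    ; lam = lam!
    ; isDepProd = isDepProd!
    ; Π-stable = Π!-stable
    ; app-stable = app!-stable
    ; lam-stable = lam!-stable
    }

lemma3p4p2p4 : ∀ {o h o' h'} (𝒞 : FullCompCat o h o' h') →
    LF (FullCompCat.K 𝒞) →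
    WeakDepProducts (FullCompCat.K 𝒞) →
    StrictDepProducts (𝒞 !)
lemma3p4p2p4 𝒞 lf wdp = DependentProducts.strictDepProducts 𝒞 lf wdp
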